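{- For all integers $s,t\ge 0$, $\alpha(s,t)\ge 0$, and $\alpha(s,t)=0$ if and only if $s=t=1$.
   Context: All matrices are over $\mathbb{F}_2$. For integers $d\ge1$, $t_0,t_d\ge0$, $t_1,\dots,t_{d-1}\ge1$, let $m=t_0+\cdots+t_d+1$ and let $\Gamma(t_0,\dots,t_d)$ be the graph with vertices $x,x_1,\dots,x_m$, path edges $x_ix_{i+1}$ ($1\le i\le m-1$), and edges from $x$ to exactly $x_{t_0+1},x_{t_0+t_1+1},\dots,x_{t_0+\cdots+t_{d-1}+1}$. With vertex order $x,x_1,\dots,x_m$ and $n=m+1$, a symmetric matrix $M\in M_n(\mathbb{F}_2)$ represents it if for $i\ne j$ the $(i,j)$-entry is $1$ exactly for adjacent vertices (diagonal arbitrary). $A(\Gamma)$ (resp. $B(\Gamma)$) is the number of representing matrices of rank $n$ (resp. $n-1$) whose lower-right $(n-1)\times(n-1)$ submatrix (indexed by $x_1,\dots,x_m$) has rank $n-2$. $\alpha=A-B$, and $\alpha(t_0,\dots,t_d)=\alpha(\Gamma(t_0,\dots,t_d))$. Here $d=1$, so $\Gamma(s,t)$ has $x$ adjacent only to $x_{s+1}$ on a path of $s+t+1$ vertices. -}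

module Defs where

open import Data.Bool using (Bool; true; false; not; _∧_; _∨_; _xor_; if_then_else_)
open import Data.Nat using (ℕ; zero; suc; _+_; _⊔_; _≡ᵇ_; _∸_)
open import Data.Fin using (Fin; zero; suc; toℕ)
open import Data.Fin.Properties using (_≟_)
open import Data.List using (List; []; _∷_; map; _++_; foldr; allFin; length; filterᵇ)
open import Data.Bool.ListAction using (all; any)
open import Data.Nat.ListAction using (sum)
open import Data.Vec as V using (Vec)
open import Data.Integer as ℤ using (ℤ; +_)
open import Relation.Nullary using (does)

-- Matrices over F₂ = Bool (xor = addition, ∧ = multiplication)
Mat : ℕ → ℕ → Set
Mat r c = Fin r → Fin c → Bool

-- all subsets of Fin n, as characteristic vectors (equivalently all vectors of F₂ⁿ)
subsets : (n : ℕ) → List (Vec Bool n)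
subsets zero    = V.[] ∷ []
subsets (suc n) = map (false V.∷_) (subsets n) ++ map (true V.∷_) (subsets n)

card : ∀ {n} → Vec Bool n → ℕ
card V.[]           = 0
card (true  V.∷ v)  = suc (card v)
card (false V.∷ v)  = card v

_⊆ᵇ_ : ∀ {n} → Vec Bool n → Vec Bool n → Bool
V.[] ⊆ᵇ V.[] = true
(a V.∷ S) ⊆ᵇ (b V.∷ T) = (not a ∨ b) ∧ (S ⊆ᵇ T)

rowSum : ∀ {r c} → Mat r c → Vec Bool r → Fin c → Bool
rowSum {r} M S j = foldr _xor_ false (map (λ i → V.lookup S i ∧ M i j) (allFin r))

isZero : ∀ {c} → (Fin c → Bool) → Bool
isZero {c} v = all (λ j → not (v j)) (allFin c)

-- the rows indexed by S are linearly independent over F₂: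
-- no nonempty subfamily sums to zero
independent : ∀ {r c} → Mat r c → Vec Bool r → Bool
independent {r} M S =
  all (λ T → not (T ⊆ᵇ S) ∨ (card T ≡ᵇ 0) ∨ not (isZero (rowSum M T))) (subsets r)

rank : ∀ {r c} → Mat r c → ℕ
rank {r} M = foldr (λ S acc → if independent M S then card S ⊔ acc else acc) 0 (subsets r)

-- Graph Γ(t₀,…,t_d) given by the list t₀ ∷ … ∷ t_d ∷ [].
-- 0-based path indices of the neighbours of x:  t₀, t₀+t₁, …, t₀+⋯+t_{d-1}
-- (i.e. the vertices x_{t₀+1}, x_{t₀+t₁+1}, …).
partialSums : ℕ → List ℕ → List ℕ
partialSums acc []               = []
partialSums acc (t ∷ [])         = []
partialSums acc (t ∷ u ∷ rest)   = (acc + t) ∷ partialSums (acc + t) (u ∷ rest)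

-- m = t₀ + ⋯ + t_d + 1 path vertices
pathLen : List ℕ → ℕ
pathLen ts = sum ts + 1

-- adjacency on vertices x (index 0), x₁,…,x_m (index 1..m)
adjΓ : (ts : List ℕ) → Fin (suc (pathLen ts)) → Fin (suc (pathLen ts)) → Bool
adjΓ ts zero    zero    = false
adjΓ ts zero    (suc j) = any (λ p → toℕ j ≡ᵇ p) (partialSums 0 ts)
adjΓ ts (suc i) zero    = any (λ p → toℕ i ≡ᵇ p) (partialSums 0 ts)
adjΓ ts (suc i) (suc j) = (suc (toℕ i) ≡ᵇ toℕ j) ∨ (suc (toℕ j) ≡ᵇ toℕ i)

-- the representing matrix with diagonal dg (representing matrices ↔ diagonals)
repMat : (ts : List ℕ) → Vec Bool (suc (pathLen ts)) → Mat (suc (pathLen ts)) (suc (pathLen ts))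
repMat ts dg i j = if does (i ≟ j) then V.lookup dg i else adjΓ ts i j

lowerRight : ∀ {m} → Mat (suc m) (suc m) → Mat m m
lowerRight M i j = M (suc i) (suc j)

-- n = m + 1
countA : List ℕ → ℕ
countA ts = length (filterᵇ (λ dg → does (rank (repMat ts dg) Data.Nat.≟ suc (pathLen ts)))
                   (filterᵇ (λ dg → does (rank (lowerRight (repMat ts dg)) Data.Nat.≟ (suc (pathLen ts) ∸ 2)))
                     (subsets (suc (pathLen ts)))))

countB : List ℕ → ℕ
countB ts = length (filterᵇ (λ dg → does (rank (repMat ts dg) Data.Nat.≟ (suc (pathLen ts) ∸ 1)))
                   (filterᵇ (λ dg → does (rank (lowerRight (repMat ts dg)) Data.Nat.≟ (suc (pathLen ts) ∸ 2)))
                     (subsets (suc (pathLen ts)))))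

α : List ℕ → ℤ
α ts = + countA ts ℤ.- + countB ts

module Submission where

-- A representing matrix of Γ(s, t) is the path matrix P = tridiagonal d (diagonal d, ones beside
-- it), bordered by a row and column eₛ (the unit vector at x_{s+1}) and a corner entry c. Over F₂
-- a left kernel vector of P is pinned down by its first entry through the three-term recurrence
-- T_{j+1} = T_{j-1} + dⱼ Tⱼ; so P has corank one exactly when the solution v started at (0, 1)
-- closes up, and then it spans the kernel. The discrete Wronskian of v with the solution u forced
-- by eₛ shows that u closes up iff vₛ = 0. Hence the whole matrix is invertible iff vₛ = 1, and has
-- corank one iff vₛ = 0 and c differs from u · eₛ, so A counts the d with v closing up and vₛ = 1
-- (twice, once for each c) and B those with vₛ = 0. Splitting the recurrence after s steps turns
-- both counts into products of counts of (non)singular path matrices, which are Jacobsthal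
-- numbers: A = 2 J(s+1) J(t+1) and B = 2 J(s) J(t). Finally J is nondecreasing and grows at every
-- step except J(1) = J(2), whence α ≥ 0 with equality only for s = t = 1.

open import Data.Bool using (Bool; true; false; not; _∧_; _∨_; _xor_; if_then_else_)
import Data.Bool as Bool
open import Data.Bool.ListAction using (all; and)
open import Data.Bool.Properties
  using (T-≡; ∨-zeroʳ; ∨-identityʳ; ∧-zeroʳ; ∧-identityʳ; xor-identityʳ; xor-same; ∧-distribʳ-xor)
open import Data.Bool.Solver using (module xor-∧-Solver)
open import Data.Empty using (⊥-elim)
open import Data.Fin using (Fin; zero; suc; toℕ)
open import Data.Fin.Properties using (_≟_)
open import Data.Integer using (+_; +≤+)
import Data.Integer as ℤ
open import Data.Integer.Properties using (m-n≡m⊖n; ⊖-≥; +-injective)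
open import Data.List using (List; []; _∷_; _++_; map; foldr; length; filterᵇ; allFin; tabulate)
open import Data.List.Membership.Propositional using (_∈_)
open import Data.List.Membership.Propositional.Properties using (∈-++⁺ˡ; ∈-++⁺ʳ; ∈-map⁺; ∈-allFin)
open import Data.List.Properties using (length-++; filter-++; map-cong; foldr-cong; map-tabulate; tabulate-cong)
open import Data.List.Relation.Unary.All as All using (All)
open import Data.List.Relation.Unary.All.Properties using (all⁺; all⁻)
open import Data.List.Relation.Unary.Any using (here; there)
open import Data.Nat using (ℕ; zero; suc; _+_; _*_; _∸_; _≤_; _<_; _⊔_; _≡ᵇ_; z≤n; s≤s)
import Data.Nat as ℕ
open import Data.Nat.Properties
  using ( ≤-refl; ≤-trans; ≤-antisym; ≤-pred; ≤-<-trans; ≤-<-connex; ≤∧≢⇒<; <-irrefl; <⇒≢; <⇒≱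
        ; 1+n≢0; 1+n≢n; 1+n≰n; m≤n⇒m≤1+n; m≤m+n; m≤n+m; m<m+n; m∸n≡0⇒m≤n
        ; m≤n⇒m≤n⊔o; m≤n⇒m≤o⊔n; ⊔-lub; +-comm; +-suc; +-identityʳ; *-distribʳ-+
        ; *-mono-≤; *-monoʳ-≤; *-monoˡ-<; *-monoʳ-<)
open import Data.Nat.Tactic.RingSolver using (solve-∀)
open import Data.Product using (_×_; _,_; proj₁; proj₂; uncurry)
open import Data.Sum using (_⊎_; inj₁; inj₂)
open import Data.Vec using (Vec; []; _∷_; lookup; replicate; zipWith)
open import Data.Vec.Properties using (lookup-zipWith; lookup-replicate; ∷-injective)
open import Defs
open import Function using (_∘_; id)
open import Function.Bundles using (Equivalence; _⇔_; mk⇔)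
open import Relation.Binary.PropositionalEquality
open import Relation.Nullary using (¬_; yes; no; does)
open import Relation.Nullary.Decidable using (dec-true; dec-false; decidable-stable; _×-dec_)

count : {A : Set} → (A → Bool) → List A → ℕ
count p xs = length (filterᵇ p xs)

count-++ : {A : Set} (p : A → Bool) (xs ys : List A) → count p (xs ++ ys) ≡ count p xs + count p ys
count-++ p xs ys = trans (cong length (filter-++ _ xs ys)) (length-++ (filterᵇ p xs))

count-map : {A B : Set} (p : B → Bool) (f : A → B) (xs : List A) → count p (map f xs) ≡ count (p ∘ f) xs
count-map p f []       = refl
count-map p f (x ∷ xs) with p (f x)
... | true  = cong suc (count-map p f xs)
... | false = count-map p f xs

count-cong : {A : Set} {p q : A → Bool} → (∀ x → p x ≡ q x) → (xs : List A) → count p xs ≡ count q xs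
count-cong p≗q [] = refl
count-cong {p = p} {q} p≗q (x ∷ xs) with p x | q x | p≗q x
... | true  | .true  | refl = cong suc (count-cong p≗q xs)
... | false | .false | refl = count-cong p≗q xs

count-false : {A : Set} (xs : List A) → count (λ _ → false) xs ≡ 0
count-false []       = refl
count-false (x ∷ xs) = count-false xs

count-filterᵇ : {A : Set} (p q : A → Bool) (xs : List A) →
  length (filterᵇ p (filterᵇ q xs)) ≡ count (λ x → q x ∧ p x) xs
count-filterᵇ p q []       = refl
count-filterᵇ p q (x ∷ xs) with q x
... | false = count-filterᵇ p q xs
... | true with p x
...   | true  = cong suc (count-filterᵇ p q xs)
...   | false = count-filterᵇ p q xs

count-∧-not : {A : Set} (p q : A → Bool) (xs : List A) →
  count (λ x → p x ∧ q x) xs + count (λ x → p x ∧ not (q x)) xs ≡ count p xs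
count-∧-not p q []       = refl
count-∧-not p q (x ∷ xs) with p x | q x
... | false | _     = count-∧-not p q xs
... | true  | true  = cong suc (count-∧-not p q xs)
... | true  | false = trans (+-suc _ _) (cong suc (count-∧-not p q xs))

count-subsets : ∀ n (p : Vec Bool (suc n) → Bool) →
  count p (subsets (suc n)) ≡ count (p ∘ (false ∷_)) (subsets n) + count (p ∘ (true ∷_)) (subsets n)
count-subsets n p = begin
  count p (map (false ∷_) (subsets n) ++ map (true ∷_) (subsets n))
    ≡⟨ count-++ p (map (false ∷_) (subsets n)) (map (true ∷_) (subsets n)) ⟩
  count p (map (false ∷_) (subsets n)) + count p (map (true ∷_) (subsets n))
    ≡⟨ cong₂ _+_ (count-map p _ (subsets n)) (count-map p _ (subsets n)) ⟩
  count (p ∘ (false ∷_)) (subsets n) + count (p ∘ (true ∷_)) (subsets n) ∎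
  where open ≡-Reasoning

all-∈ : {A : Set} (p : A → Bool) {xs : List A} {x : A} → all p xs ≡ true → x ∈ xs → p x ≡ true
all-∈ p all≡true x∈xs = Equivalence.to T-≡ (All.lookup (all⁺ p _ (Equivalence.from T-≡ all≡true)) x∈xs)

all-universal : {A : Set} (p : A → Bool) → (∀ x → p x ≡ true) → (xs : List A) → all p xs ≡ true
all-universal p p≡true xs = Equivalence.to T-≡ (all⁻ p (All.universal (Equivalence.from T-≡ ∘ p≡true) xs))

infix  4 _⊆_
infixr 6 _⊕_
infix  7 _·_

_⊆_ : ∀ {n} → Vec Bool n → Vec Bool n → Set
T ⊆ S = (T ⊆ᵇ S) ≡ true

_⊕_ : ∀ {n} → Vec Bool n → Vec Bool n → Vec Bool n
_⊕_ = zipWith _xor_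

_·_ : ∀ {n} → Vec Bool n → Vec Bool n → Bool
[]      · []      = false
(x ∷ T) · (y ∷ U) = (x ∧ y) xor (T · U)

full : ∀ n → Vec Bool n
full n = replicate n true

zeros : ∀ n → Vec Bool n
zeros n = replicate n false

first : ∀ {n} → Vec Bool n → Bool
first []      = false
first (x ∷ _) = x

-- Entry s of a vector, read as false outside its range.
entry : ∀ {n} → Vec Bool n → ℕ → Bool
entry []      _       = false
entry (x ∷ _) zero    = x
entry (_ ∷ T) (suc s) = entry T s

unit : ℕ → ∀ n → Vec Bool n
unit s       zero    = []
unit zero    (suc n) = true ∷ zeros n
unit (suc s) (suc n) = false ∷ unit s n

true≢false : true ≢ false
true≢false ()

xor≡false⇒≡ : ∀ {a b} → a xor b ≡ false → a ≡ b
xor≡false⇒≡ {false} {false} _ = refl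
xor≡false⇒≡ {true}  {true}  _ = refl

≡⇒xor≡false : ∀ {a b} → a ≡ b → a xor b ≡ false
≡⇒xor≡false {a} refl = xor-same a

≢⇒xor≡true : ∀ {a b} → a ≢ b → a xor b ≡ true
≢⇒xor≡true {false} {false} a≢b = ⊥-elim (a≢b refl)
≢⇒xor≡true {false} {true}  _   = refl
≢⇒xor≡true {true}  {false} _   = refl
≢⇒xor≡true {true}  {true}  a≢b = ⊥-elim (a≢b refl)

lookup-ext : ∀ {n} {x y : Vec Bool n} → (∀ j → lookup x j ≡ lookup y j) → x ≡ y
lookup-ext {x = []}    {[]}    _   = refl
lookup-ext {x = _ ∷ _} {_ ∷ _} x≗y = cong₂ _∷_ (x≗y zero) (lookup-ext (x≗y ∘ suc))

lookup-unit : ∀ s {n} (i : Fin n) → lookup (unit s n) i ≡ (toℕ i ≡ᵇ s)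
lookup-unit zero    zero    = refl
lookup-unit (suc s) zero    = refl
lookup-unit zero    (suc i) = lookup-replicate i false
lookup-unit (suc s) (suc i) = lookup-unit s i

·-zeros : ∀ {n} (T : Vec Bool n) → T · zeros n ≡ false
·-zeros []      = refl
·-zeros (x ∷ T) rewrite ∧-zeroʳ x = ·-zeros T

·-unit : ∀ s {n} (T : Vec Bool n) → T · unit s n ≡ entry T s
·-unit s       []      = refl
·-unit zero    (x ∷ T) rewrite ∧-identityʳ x | ·-zeros T = xor-identityʳ x
·-unit (suc s) (x ∷ T) rewrite ∧-zeroʳ x = ·-unit s T

card-full : ∀ n → card (full n) ≡ n
card-full zero    = refl
card-full (suc n) = cong suc (card-full n)

card-zeros : ∀ n → card (zeros n) ≡ 0
card-zeros zero    = refl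
card-zeros (suc n) = card-zeros n

card≢0⇒≢zeros : ∀ {n} {T : Vec Bool n} → card T ≢ 0 → T ≢ zeros n
card≢0⇒≢zeros {n} |T|≢0 refl = |T|≢0 (card-zeros n)

first≡true⇒card≢0 : ∀ {n} (T : Vec Bool n) → first T ≡ true → card T ≢ 0
first≡true⇒card≢0 (true ∷ _) _ ()

card≤length : ∀ {n} (S : Vec Bool n) → card S ≤ n
card≤length []          = z≤n
card≤length (true ∷ S)  = s≤s (card≤length S)
card≤length (false ∷ S) = m≤n⇒m≤1+n (card≤length S)

card≡length⇒full : ∀ {n} (S : Vec Bool n) → card S ≡ n → S ≡ full n
card≡length⇒full []          _  = refl
card≡length⇒full (true ∷ S)  eq = cong (true ∷_) (card≡length⇒full S (cong ℕ.pred eq))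
card≡length⇒full {suc n} (false ∷ S) eq = ⊥-elim (<-irrefl refl (subst (_≤ n) eq (card≤length S)))

⊆-full : ∀ {n} (T : Vec Bool n) → T ⊆ full n
⊆-full []          = refl
⊆-full (false ∷ T) = ⊆-full T
⊆-full (true ∷ T)  = ⊆-full T

⊆-false∷ : ∀ {n} (T : Vec Bool (suc n)) {S} → T ⊆ false ∷ S → first T ≡ false
⊆-false∷ (false ∷ _) _ = refl

-- If S misses at most one coordinate i, one of x, y, x ⊕ y vanishes at i.
⊆-one-of : ∀ {n} (S x y : Vec Bool n) → n ≤ suc (card S) → x ⊆ S ⊎ y ⊆ S ⊎ x ⊕ y ⊆ S
⊆-one-of [] [] [] _ = inj₁ refl
⊆-one-of (true ∷ S) (a ∷ x) (b ∷ y) (s≤s n≤) with ⊆-one-of S x y n≤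
... | inj₁ x⊆S         rewrite x⊆S   | ∨-zeroʳ (not a)         = inj₁ refl
... | inj₂ (inj₁ y⊆S)   rewrite y⊆S   | ∨-zeroʳ (not b)         = inj₂ (inj₁ refl)
... | inj₂ (inj₂ x⊕y⊆S) rewrite x⊕y⊆S | ∨-zeroʳ (not (a xor b)) = inj₂ (inj₂ refl)
⊆-one-of (false ∷ S) (a ∷ x) (b ∷ y) (s≤s n≤)
  rewrite card≡length⇒full S (≤-antisym (card≤length S) n≤) with a | b
... | false | _     = inj₁ (⊆-full x)
... | true  | false = inj₂ (inj₁ (⊆-full y))
... | true  | true  = inj₂ (inj₂ (⊆-full (x ⊕ y)))

-- Rank over F₂

Σ⊕ : ∀ {r} → (Fin r → Bool) → Bool
Σ⊕ f = foldr _xor_ false (tabulate f)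

Σ⊕-xor : ∀ {r} (f g : Fin r → Bool) → Σ⊕ (λ i → f i xor g i) ≡ Σ⊕ f xor Σ⊕ g
Σ⊕-xor {zero}  f g = refl
Σ⊕-xor {suc r} f g = trans (cong ((f zero xor g zero) xor_) (Σ⊕-xor (f ∘ suc) (g ∘ suc)))
                          (interchange (f zero) (g zero) (Σ⊕ (f ∘ suc)) (Σ⊕ (g ∘ suc)))
  where
  open xor-∧-Solver
  interchange : ∀ a b c d → (a xor b) xor (c xor d) ≡ (a xor c) xor (b xor d)
  interchange = solve 4 (λ a b c d → (a :+ b) :+ (c :+ d) := (a :+ c) :+ (b :+ d)) refl

Σ⊕-· : ∀ {n} (T U : Vec Bool n) → Σ⊕ (λ i → lookup T i ∧ lookup U i) ≡ T · U
Σ⊕-· []      []      = refl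
Σ⊕-· (x ∷ T) (y ∷ U) = cong ((x ∧ y) xor_) (Σ⊕-· T U)

rowSum-Σ⊕ : ∀ {r c} (M : Mat r c) S j → rowSum M S j ≡ Σ⊕ (λ i → lookup S i ∧ M i j)
rowSum-Σ⊕ M S j = cong (foldr _xor_ false) (map-tabulate id (λ i → lookup S i ∧ M i j))

LeftKernel : ∀ {r c} → Mat r c → Vec Bool r → Set
LeftKernel M T = ∀ j → rowSum M T j ≡ false

LeftKernel-⊕ : ∀ {r c} (M : Mat r c) x y → LeftKernel M x → LeftKernel M y → LeftKernel M (x ⊕ y)
LeftKernel-⊕ M x y x∈ker y∈ker j = begin
  rowSum M (x ⊕ y) j
    ≡⟨ rowSum-Σ⊕ M (x ⊕ y) j ⟩
  Σ⊕ (λ i → lookup (x ⊕ y) i ∧ M i j)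
    ≡⟨ cong (foldr _xor_ false) (tabulate-cong λ i →
         trans (cong (_∧ M i j) (lookup-zipWith _xor_ i x y)) (∧-distribʳ-xor (M i j) (lookup x i) (lookup y i))) ⟩
  Σ⊕ (λ i → (lookup x i ∧ M i j) xor (lookup y i ∧ M i j))
    ≡⟨ Σ⊕-xor (λ i → lookup x i ∧ M i j) (λ i → lookup y i ∧ M i j) ⟩
  Σ⊕ (λ i → lookup x i ∧ M i j) xor Σ⊕ (λ i → lookup y i ∧ M i j)
    ≡⟨ cong₂ _xor_ (trans (sym (rowSum-Σ⊕ M x j)) (x∈ker j)) (trans (sym (rowSum-Σ⊕ M y j)) (y∈ker j)) ⟩
  false ∎
  where open ≡-Reasoning

subsets-complete : ∀ {n} (S : Vec Bool n) → S ∈ subsets n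
subsets-complete []                  = here refl
subsets-complete {suc n} (false ∷ S) = ∈-++⁺ˡ (∈-map⁺ (false ∷_) (subsets-complete S))
subsets-complete {suc n} (true ∷ S)  =
  ∈-++⁺ʳ (map (false ∷_) (subsets n)) (∈-map⁺ (true ∷_) (subsets-complete S))

isZero-elim : ∀ {c} (v : Fin c → Bool) → isZero v ≡ true → ∀ j → v j ≡ false
isZero-elim v v≡0 j with v j | all-∈ (λ j → not (v j)) v≡0 (∈-allFin j)
... | false | _ = refl
... | true  | ()

isZero-intro : ∀ {c} (v : Fin c → Bool) → (∀ j → v j ≡ false) → isZero v ≡ true
isZero-intro {c} v v≡0 = all-universal (λ j → not (v j)) (cong not ∘ v≡0) (allFin c)

independent-intro : ∀ {r c} (M : Mat r c) S →
  (∀ T → T ⊆ S → card T ≢ 0 → ¬ LeftKernel M T) → independent M S ≡ true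
independent-intro {r} M S noKernel = all-universal _ holds (subsets r)
  where
  holds : ∀ T → (not (T ⊆ᵇ S) ∨ (card T ≡ᵇ 0) ∨ not (isZero (rowSum M T))) ≡ true
  holds T with T ⊆ᵇ S in T⊆S | card T in |T| | isZero (rowSum M T) in T∈ker
  ... | false | _     | _     = refl
  ... | true  | zero  | _     = refl
  ... | true  | suc _ | false = refl
  ... | true  | suc _ | true  =
    ⊥-elim (noKernel T T⊆S (1+n≢0 ∘ trans (sym |T|)) (isZero-elim (rowSum M T) T∈ker))

independent-elim : ∀ {r c} (M : Mat r c) {S} T →
  independent M S ≡ true → T ⊆ S → card T ≢ 0 → ¬ LeftKernel M T
independent-elim M T indep T⊆S |T|≢0 T∈ker with all-∈ _ indep (subsets-complete T)
... | holds rewrite T⊆S | isZero-intro (rowSum M T) T∈ker with card T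
...   | zero  = |T|≢0 refl
...   | suc _ with holds
...     | ()

independent⇒card≤rank : ∀ {r c} (M : Mat r c) {S} → independent M S ≡ true → card S ≤ rank M
independent⇒card≤rank {r} M {S} indep = go (subsets r) (subsets-complete S)
  where
  go : ∀ Ss → S ∈ Ss → card S ≤ foldr (λ S acc → if independent M S then card S ⊔ acc else acc) 0 Ss
  go (_ ∷ Ss)  (here refl)  rewrite indep = m≤n⇒m≤n⊔o _ ≤-refl
  go (S′ ∷ Ss) (there S∈Ss) with independent M S′
  ... | true  = m≤n⇒m≤o⊔n (card S′) (go Ss S∈Ss)
  ... | false = go Ss S∈Ss

rank≤ : ∀ {r c} (M : Mat r c) k → (∀ S → independent M S ≡ true → card S ≤ k) → rank M ≤ k
rank≤ {r} M k bound = go (subsets r)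
  where
  go : ∀ Ss → foldr (λ S acc → if independent M S then card S ⊔ acc else acc) 0 Ss ≤ k
  go []       = z≤n
  go (S ∷ Ss) with independent M S in indep
  ... | true  = ⊔-lub (bound S indep) (go Ss)
  ... | false = go Ss

rank≡rows : ∀ {r c} (M : Mat r c) → (∀ T → card T ≢ 0 → ¬ LeftKernel M T) → rank M ≡ r
rank≡rows {r} M noKernel = ≤-antisym
  (rank≤ M r (λ S _ → card≤length S))
  (subst (_≤ rank M) (card-full r)
    (independent⇒card≤rank M (independent-intro M (full r) (λ T _ → noKernel T))))

rank<rows : ∀ {r c} (M : Mat r c) T → card T ≢ 0 → LeftKernel M T → rank M < r
rank<rows {zero}  M [] |T|≢0 _     = ⊥-elim (|T|≢0 refl)
rank<rows {suc r} M T  |T|≢0 T∈ker = s≤s (rank≤ M r λ S indep → ≤-pred (≤∧≢⇒< (card≤length S) λ |S|≡1+r →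
  independent-elim M T indep (subst (T ⊆_) (sym (card≡length⇒full S |S|≡1+r)) (⊆-full T)) |T|≢0 T∈ker))

rank≤rows∸2 : ∀ {r c} (M : Mat (suc (suc r)) c) x y →
  card x ≢ 0 → card y ≢ 0 → card (x ⊕ y) ≢ 0 → LeftKernel M x → LeftKernel M y → rank M ≤ r
rank≤rows∸2 {r} M x y |x|≢0 |y|≢0 |x⊕y|≢0 x∈ker y∈ker = rank≤ M r bound
  where
  bound : ∀ S → independent M S ≡ true → card S ≤ r
  bound S indep with ≤-<-connex (card S) r
  ... | inj₁ |S|≤r = |S|≤r
  ... | inj₂ r<|S| with ⊆-one-of S x y (s≤s r<|S|)
  ...   | inj₁ x⊆S         = ⊥-elim (independent-elim M x indep x⊆S |x|≢0 x∈ker)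
  ...   | inj₂ (inj₁ y⊆S)   = ⊥-elim (independent-elim M y indep y⊆S |y|≢0 y∈ker)
  ...   | inj₂ (inj₂ x⊕y⊆S) =
    ⊥-elim (independent-elim M (x ⊕ y) indep x⊕y⊆S |x⊕y|≢0 (LeftKernel-⊕ M x y x∈ker y∈ker))

rank-cong : ∀ {r c} {M N : Mat r c} → (∀ i j → M i j ≡ N i j) → rank M ≡ rank N
rank-cong {r} {c} {M} {N} M≗N =
  foldr-cong (λ S acc → cong (λ b → if b then card S ⊔ acc else acc) (independent-cong S)) refl (subsets r)
  where
  rowSum-cong : ∀ T j → rowSum M T j ≡ rowSum N T j
  rowSum-cong T j = cong (foldr _xor_ false) (map-cong (λ i → cong (lookup T i ∧_) (M≗N i j)) (allFin r))
  independent-cong : ∀ S → independent M S ≡ independent N S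
  independent-cong S = cong and (map-cong (λ T →
    cong (λ z → not (T ⊆ᵇ S) ∨ (card T ≡ᵇ 0) ∨ not z)
      (cong and (map-cong (λ j → cong not (rowSum-cong T j)) (allFin c)))) (subsets r))

-- The path matrix and its three-term recurrence

tridiagonal : ∀ {m} → Vec Bool m → Mat m m
tridiagonal d i j =
  if does (i ≟ j) then lookup d i else ((suc (toℕ i) ≡ᵇ toℕ j) ∨ (suc (toℕ j) ≡ᵇ toℕ i))

bordered : ∀ {m} → Bool → Vec Bool m → Vec Bool m → Mat (suc m) (suc m)
bordered c e d zero    zero    = c
bordered c e d zero    (suc j) = lookup e j
bordered c e d (suc i) zero    = lookup e i
bordered c e d (suc i) (suc j) = tridiagonal d i j

-- pathProduct d p T = T · tridiagonal d, where p is the entry of T preceding T's first one.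
pathProduct : ∀ {m} → Vec Bool m → Bool → Vec Bool m → Vec Bool m
pathProduct []       p []      = []
pathProduct (dⱼ ∷ d) p (x ∷ T) = (p xor ((x ∧ dⱼ) xor first T)) ∷ pathProduct d x T

rowSum-tridiagonal : ∀ {m} (d T : Vec Bool m) j →
  rowSum (tridiagonal d) T j ≡ lookup (pathProduct d false T) j
rowSum-tridiagonal d T j = trans (rowSum-Σ⊕ (tridiagonal d) T j) (sym (pathProduct-lookup d false T j))
  where
  isFirst : ∀ {m} → Fin m → Bool
  isFirst zero    = true
  isFirst (suc _) = false

  Σ⊕-first : ∀ {m} (T : Vec Bool m) → Σ⊕ (λ i → lookup T i ∧ (0 ≡ᵇ toℕ i)) ≡ first T
  Σ⊕-first [] = refl
  Σ⊕-first {suc m} (x ∷ T) rewrite ∧-identityʳ x = trans (cong (x xor_) (Σ⊕-zero T)) (xor-identityʳ x)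
    where
    Σ⊕-zero : ∀ {m} (T : Vec Bool m) → Σ⊕ (λ i → lookup T i ∧ false) ≡ false
    Σ⊕-zero []      = refl
    Σ⊕-zero (x ∷ T) rewrite ∧-zeroʳ x = Σ⊕-zero T

  pathProduct-lookup : ∀ {m} (d : Vec Bool m) p T j →
    lookup (pathProduct d p T) j ≡ (p ∧ isFirst j) xor Σ⊕ (λ i → lookup T i ∧ tridiagonal d i j)
  pathProduct-lookup (dⱼ ∷ d) p (x ∷ T) zero rewrite Σ⊕-first T | ∧-identityʳ p = refl
  pathProduct-lookup (dⱼ ∷ d) p (x ∷ T) (suc j) rewrite ∧-zeroʳ p =
    trans (pathProduct-lookup d x T j) (cong (_xor _) (cong (x ∧_) (isFirst-tridiagonal j)))
    where
    isFirst-tridiagonal : ∀ {m} (j : Fin m) → isFirst j ≡ ((0 ≡ᵇ toℕ j) ∨ false)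
    isFirst-tridiagonal zero    = refl
    isFirst-tridiagonal (suc j) = refl

tridiagonal-kernel : ∀ {m} (d T : Vec Bool m) →
  LeftKernel (tridiagonal d) T ⇔ pathProduct d false T ≡ zeros m
tridiagonal-kernel {m} d T = mk⇔
  (λ T∈ker → lookup-ext λ j →
    trans (sym (rowSum-tridiagonal d T j)) (trans (T∈ker j) (sym (lookup-replicate j false))))
  (λ TP≡0 j →
    trans (rowSum-tridiagonal d T j) (trans (cong (λ U → lookup U j) TP≡0) (lookup-replicate j false)))

forcing : ∀ {m} → Bool → Vec Bool m → Vec Bool m
forcing a e = if a then e else zeros _

lookup-forcing : ∀ {m} a (e : Vec Bool m) j → lookup (forcing a e) j ≡ a ∧ lookup e j
lookup-forcing true  e j = refl
lookup-forcing false e j = lookup-replicate j false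

bordered-kernel : ∀ {m} c (e d : Vec Bool m) a T →
  LeftKernel (bordered c e d) (a ∷ T) ⇔ ((a ∧ c) xor (T · e) ≡ false × pathProduct d false T ≡ forcing a e)
bordered-kernel c e d a T = mk⇔
  (λ T∈ker → trans (sym column₀) (T∈ker zero) , lookup-ext λ j →
    trans (sym (xor≡false⇒≡ (trans (sym (column j)) (T∈ker (suc j))))) (sym (lookup-forcing a e j)))
  (λ { (column₀≡0 , TP≡ae) → λ
       { zero    → trans column₀ column₀≡0
       ; (suc j) → trans (column j) (≡⇒xor≡false
                     (trans (sym (lookup-forcing a e j)) (cong (λ U → lookup U j) (sym TP≡ae)))) } })
  where
  M = bordered c e d
  column₀ : rowSum M (a ∷ T) zero ≡ (a ∧ c) xor (T · e)
  column₀ = trans (rowSum-Σ⊕ M (a ∷ T) zero) (cong ((a ∧ c) xor_) (Σ⊕-· T e))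
  column : ∀ j → rowSum M (a ∷ T) (suc j) ≡ (a ∧ lookup e j) xor lookup (pathProduct d false T) j
  column j = trans (rowSum-Σ⊕ M (a ∷ T) (suc j)) (cong ((a ∧ lookup e j) xor_)
    (trans (sym (rowSum-Σ⊕ (tridiagonal d) T j)) (rowSum-tridiagonal d T j)))

next : (fⱼ dⱼ p q : Bool) → Bool
next fⱼ dⱼ p q = (fⱼ xor (dⱼ ∧ q)) xor p

-- solution f d p q is the unique T with T₀ = q satisfying all columns of pathProduct d p T ≡ f
-- but the last; final f d p q = (Tₘ₋₁ , Tₘ), where Tₘ is the entry the last column would need,
-- so that column holds iff overflow f d p q ≡ false.
solution : ∀ {m} (f d : Vec Bool m) (p q : Bool) → Vec Bool m
solution []       []       p q = []
solution (fⱼ ∷ f) (dⱼ ∷ d) p q = q ∷ solution f d q (next fⱼ dⱼ p q)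

final : ∀ {m} (f d : Vec Bool m) (p q : Bool) → Bool × Bool
final []       []       p q = p , q
final (fⱼ ∷ f) (dⱼ ∷ d) p q = final f d q (next fⱼ dⱼ p q)

overflow : ∀ {m} (f d : Vec Bool m) (p q : Bool) → Bool
overflow f d p q = proj₂ (final f d p q)

first-solution : ∀ {m} (f d : Vec Bool m) p q → overflow f d p q ≡ false → first (solution f d p q) ≡ q
first-solution []      []      p q ovf = sym ovf
first-solution (_ ∷ _) (_ ∷ _) p q ovf = refl

solution-zeros : ∀ {m} (d : Vec Bool m) → solution (zeros m) d false false ≡ zeros m
solution-zeros []       = refl
solution-zeros (dⱼ ∷ d) rewrite ∧-zeroʳ dⱼ = cong (false ∷_) (solution-zeros d)

pathProduct-solution : ∀ {m} (f d : Vec Bool m) p q →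
  overflow f d p q ≡ false → pathProduct d p (solution f d p q) ≡ f
pathProduct-solution []       []       p q ovf = refl
pathProduct-solution (fⱼ ∷ f) (dⱼ ∷ d) p q ovf rewrite first-solution f d q (next fⱼ dⱼ p q) ovf =
  cong₂ _∷_ (column fⱼ dⱼ p q) (pathProduct-solution f d q (next fⱼ dⱼ p q) ovf)
  where
  open xor-∧-Solver
  column : ∀ fⱼ dⱼ p q → p xor ((q ∧ dⱼ) xor next fⱼ dⱼ p q) ≡ fⱼ
  column = solve 4 (λ fⱼ dⱼ p q → p :+ ((q :* dⱼ) :+ ((fⱼ :+ (dⱼ :* q)) :+ p)) := fⱼ) refl

solution-unique : ∀ {m} (f d : Vec Bool m) p T →
  pathProduct d p T ≡ f → T ≡ solution f d p (first T) × overflow f d p (first T) ≡ false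
solution-unique []       []       p []      _  = refl , refl
solution-unique (fⱼ ∷ f) (dⱼ ∷ d) p (x ∷ T) eq with ∷-injective eq
... | column , TP≡f with solution-unique f d x T TP≡f
...   | T≡ , ovf = subst (λ b → x ∷ T ≡ x ∷ solution f d x b × overflow f d x b ≡ false)
                         (trans (rearrange p x dⱼ (first T)) (cong (λ φ → (φ xor (dⱼ ∧ x)) xor p) column))
                         (cong (x ∷_) T≡ , ovf)
  where
  open xor-∧-Solver
  rearrange : ∀ p x dⱼ y → y ≡ ((p xor ((x ∧ dⱼ) xor y)) xor (dⱼ ∧ x)) xor p
  rearrange = solve 4 (λ p x dⱼ y → y := ((p :+ ((x :* dⱼ) :+ y)) :+ (dⱼ :* x)) :+ p) refl

nonzero-next : ∀ dⱼ p q → p ∨ q ≡ true → q ∨ next false dⱼ p q ≡ true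
nonzero-next dⱼ    p     true  _ = refl
nonzero-next false true  false _ = refl
nonzero-next true  true  false _ = refl

final-nonzero : ∀ {m} (d : Vec Bool m) p q →
  p ∨ q ≡ true → uncurry _∨_ (final (zeros m) d p q) ≡ true
final-nonzero []       p q nz = nz
final-nonzero (dⱼ ∷ d) p q nz = final-nonzero d q (next false dⱼ p q) (nonzero-next dⱼ p q nz)

casoratian : Bool × Bool → Bool × Bool → Bool
casoratian (a , b) (c , d) = (a ∧ d) xor (b ∧ c)

casoratian-final : ∀ {m} (f d : Vec Bool m) pu qu pv qv →
  casoratian (final f d pu qu) (final (zeros m) d pv qv)
    ≡ casoratian (pu , qu) (pv , qv) xor (solution (zeros m) d pv qv · f)
casoratian-final []       []       pu qu pv qv = sym (xor-identityʳ _)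
casoratian-final (fⱼ ∷ f) (dⱼ ∷ d) pu qu pv qv =
  trans (casoratian-final f d qu (next fⱼ dⱼ pu qu) qv (next false dⱼ pv qv))
        (step pu qu pv qv dⱼ fⱼ (solution (zeros _) d qv (next false dⱼ pv qv) · f))
  where
  open xor-∧-Solver
  step : ∀ pu qu pv qv dⱼ fⱼ r →
    casoratian (qu , next fⱼ dⱼ pu qu) (qv , next false dⱼ pv qv) xor r
      ≡ casoratian (pu , qu) (pv , qv) xor ((qv ∧ fⱼ) xor r)
  step = solve 7 (λ pu qu pv qv dⱼ fⱼ r →
    ((qu :* ((dⱼ :* qv) :+ pv)) :+ (((fⱼ :+ (dⱼ :* qu)) :+ pu) :* qv)) :+ r
      := ((pu :* qv) :+ (qu :* pv)) :+ ((qv :* fⱼ) :+ r)) refl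

module BorderedPath {m : ℕ} (c : Bool) (e d : Vec Bool (suc m)) where

  P : Mat (suc m) (suc m)
  P = tridiagonal d

  M : Mat (suc (suc m)) (suc (suc m))
  M = bordered c e d

  -- δ is the determinant of P; when δ ≡ false, v spans the left kernel of P.
  δ : Bool
  δ = overflow (zeros (suc m)) d false true

  v : Vec Bool (suc m)
  v = solution (zeros (suc m)) d false true

  u : Bool → Vec Bool (suc m)
  u b = solution e d false b

  first-v : δ ≡ false → first v ≡ true
  first-v = first-solution (zeros (suc m)) d false true

  card-v : δ ≡ false → card v ≢ 0
  card-v δ≡0 = first≡true⇒card≢0 v (first-v δ≡0)

  final-v : δ ≡ false → final (zeros (suc m)) d false true ≡ (true , false)
  final-v δ≡0 with final (zeros (suc m)) d false true | final-nonzero d false true refl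
  ... | (true  , _) | _  = cong (true ,_) δ≡0
  ... | (false , _) | nz = ⊥-elim (true≢false (trans (sym nz) δ≡0))

  overflow-u : δ ≡ false → ∀ b → overflow e d false b ≡ v · e
  overflow-u δ≡0 b = begin
    overflow e d false b
      ≡⟨ sym (casoratian-10 (final e d false b)) ⟩
    casoratian (final e d false b) (true , false)
      ≡⟨ cong (casoratian (final e d false b)) (sym (final-v δ≡0)) ⟩
    casoratian (final e d false b) (final (zeros (suc m)) d false true)
      ≡⟨ casoratian-final e d false b false true ⟩
    (b ∧ false) xor (v · e)
      ≡⟨ cong (_xor (v · e)) (∧-zeroʳ b) ⟩
    v · e ∎
    where
    open ≡-Reasoning
    casoratian-10 : ∀ x → casoratian x (true , false) ≡ proj₂ x
    casoratian-10 (a , b) rewrite ∧-zeroʳ a | ∧-identityʳ b = refl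

  homogeneous-solution : ∀ {T} → pathProduct d false T ≡ zeros (suc m) →
    T ≡ zeros (suc m) ⊎ (T ≡ v × δ ≡ false)
  homogeneous-solution {T} TP≡0 with solution-unique (zeros (suc m)) d false T TP≡0
  ... | T≡ , ovf with first T
  ...   | false = inj₁ (trans T≡ (solution-zeros d))
  ...   | true  = inj₂ (T≡ , ovf)

  forced-solution : δ ≡ false → ∀ {T} → pathProduct d false T ≡ e → T ≡ u (first T) × v · e ≡ false
  forced-solution δ≡0 {T} TP≡e with solution-unique e d false T TP≡e
  ... | T≡ , ovf = T≡ , trans (sym (overflow-u δ≡0 (first T))) ovf

  v-solves : δ ≡ false → pathProduct d false v ≡ zeros (suc m)
  v-solves = pathProduct-solution (zeros (suc m)) d false true

  u-solves : δ ≡ false → v · e ≡ false → ∀ b → pathProduct d false (u b) ≡ e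
  u-solves δ≡0 ve≡0 b = pathProduct-solution e d false b (trans (overflow-u δ≡0 b) ve≡0)

  rankP-nonsingular : δ ≡ true → rank P ≡ suc m
  rankP-nonsingular δ≡1 = rank≡rows P noKernel
    where
    noKernel : ∀ T → card T ≢ 0 → ¬ LeftKernel P T
    noKernel T |T|≢0 T∈ker with homogeneous-solution (Equivalence.to (tridiagonal-kernel d T) T∈ker)
    ... | inj₁ T≡0       = card≢0⇒≢zeros |T|≢0 T≡0
    ... | inj₂ (_ , δ≡0) = true≢false (trans (sym δ≡1) δ≡0)

  rankP-singular : δ ≡ false → rank P ≡ m
  rankP-singular δ≡0 = ≤-antisym
    (≤-pred (rank<rows P v (card-v δ≡0) (Equivalence.from (tridiagonal-kernel d v) (v-solves δ≡0))))
    (subst (_≤ rank P) (card-full m)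
      (independent⇒card≤rank P (independent-intro P (false ∷ full m) noKernel)))
    where
    noKernel : ∀ T → T ⊆ false ∷ full m → card T ≢ 0 → ¬ LeftKernel P T
    noKernel T T⊆ |T|≢0 T∈ker with homogeneous-solution (Equivalence.to (tridiagonal-kernel d T) T∈ker)
    ... | inj₁ T≡0       = card≢0⇒≢zeros |T|≢0 T≡0
    ... | inj₂ (T≡v , _) =
      true≢false (trans (sym (first-v δ≡0)) (trans (cong first (sym T≡v)) (⊆-false∷ T T⊆)))

  rankM-full : δ ≡ false → v · e ≡ true → rank M ≡ suc (suc m)
  rankM-full δ≡0 ve≡1 = rank≡rows M noKernel
    where
    noKernel : ∀ T → card T ≢ 0 → ¬ LeftKernel M T
    noKernel (a ∷ T) |aT|≢0 aT∈ker with a | Equivalence.to (bordered-kernel c e d a T) aT∈ker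
    ... | true  | _ , TP≡e = true≢false (trans (sym ve≡1) (proj₂ (forced-solution δ≡0 TP≡e)))
    ... | false | Te≡0 , TP≡0 with homogeneous-solution TP≡0
    ...   | inj₁ T≡0       = card≢0⇒≢zeros |aT|≢0 (cong (false ∷_) T≡0)
    ...   | inj₂ (T≡v , _) = true≢false (trans (sym ve≡1) (trans (cong (_· e) (sym T≡v)) Te≡0))

  v-kernel : δ ≡ false → v · e ≡ false → LeftKernel M (false ∷ v)
  v-kernel δ≡0 ve≡0 = Equivalence.from (bordered-kernel c e d false v) (ve≡0 , v-solves δ≡0)

  rankM<full : δ ≡ false → v · e ≡ false → rank M < suc (suc m)
  rankM<full δ≡0 ve≡0 = rank<rows M (false ∷ v) (card-v δ≡0) (v-kernel δ≡0 ve≡0)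

  rankM-corank₁ : δ ≡ false → v · e ≡ false → c ≢ u false · e → rank M ≡ suc m
  rankM-corank₁ δ≡0 ve≡0 c≢ = ≤-antisym
    (≤-pred (rankM<full δ≡0 ve≡0))
    (subst (_≤ rank M) (cong suc (card-full m))
      (independent⇒card≤rank M (independent-intro M (true ∷ false ∷ full m) noKernel)))
    where
    noKernel : ∀ T → T ⊆ true ∷ false ∷ full m → card T ≢ 0 → ¬ LeftKernel M T
    noKernel (false ∷ T) T⊆ |aT|≢0 aT∈ker
      with homogeneous-solution (proj₂ (Equivalence.to (bordered-kernel c e d false T) aT∈ker))
    ... | inj₁ T≡0       = card≢0⇒≢zeros |aT|≢0 (cong (false ∷_) T≡0)
    ... | inj₂ (T≡v , _) =
      true≢false (trans (sym (first-v δ≡0)) (trans (cong first (sym T≡v)) (⊆-false∷ T T⊆)))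
    noKernel (true ∷ T) T⊆ |aT|≢0 aT∈ker with Equivalence.to (bordered-kernel c e d true T) aT∈ker
    ... | c≡Te , TP≡e with forced-solution δ≡0 TP≡e
    ...   | T≡u , _ = c≢ (trans (xor≡false⇒≡ c≡Te) (cong (_· e) (trans T≡u (cong u (⊆-false∷ T T⊆)))))

  rankM-corank₂ : δ ≡ false → v · e ≡ false → c ≡ u false · e → rank M ≤ m
  rankM-corank₂ δ≡0 ve≡0 c≡ = rank≤rows∸2 M (false ∷ v) (true ∷ u false)
    (card-v δ≡0) (λ ()) (λ ())
    (v-kernel δ≡0 ve≡0)
    (Equivalence.from (bordered-kernel c e d true (u false)) (≡⇒xor≡false c≡ , u-solves δ≡0 ve≡0 false))

  A-condition : does (rank P ℕ.≟ m) ∧ does (rank M ℕ.≟ suc (suc m)) ≡ not δ ∧ (v · e)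
  A-condition with δ in δ≡
  ... | true rewrite rankP-nonsingular δ≡ =
    cong (_∧ does (rank M ℕ.≟ suc (suc m))) (dec-false (suc m ℕ.≟ m) 1+n≢n)
  ... | false rewrite rankP-singular δ≡ | dec-true (m ℕ.≟ m) refl with v · e in ve≡
  ...   | true  = dec-true (rank M ℕ.≟ suc (suc m)) (rankM-full δ≡ ve≡)
  ...   | false = dec-false (rank M ℕ.≟ suc (suc m)) (<⇒≢ (rankM<full δ≡ ve≡))

  B-condition : does (rank P ℕ.≟ m) ∧ does (rank M ℕ.≟ suc m) ≡ (not δ ∧ not (v · e)) ∧ (c xor (u false · e))
  B-condition with δ in δ≡
  ... | true rewrite rankP-nonsingular δ≡ =
    cong (_∧ does (rank M ℕ.≟ suc m)) (dec-false (suc m ℕ.≟ m) 1+n≢n)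
  ... | false rewrite rankP-singular δ≡ | dec-true (m ℕ.≟ m) refl with v · e in ve≡
  ...   | true rewrite rankM-full δ≡ ve≡ = dec-false (suc (suc m) ℕ.≟ suc m) 1+n≢n
  ...   | false with c Bool.≟ u false · e
  ...     | yes c≡ = trans
    (dec-false (rank M ℕ.≟ suc m) (λ rank≡1+m → 1+n≰n (subst (_≤ m) rank≡1+m (rankM-corank₂ δ≡ ve≡ c≡))))
    (sym (≡⇒xor≡false c≡))
  ...     | no c≢  = trans (dec-true (rank M ℕ.≟ suc m) (rankM-corank₁ δ≡ ve≡ c≢)) (sym (≢⇒xor≡true c≢))

-- Jacobsthal numbers and counts of diagonals

jacobsthal : ℕ → ℕ
jacobsthal 0             = 0
jacobsthal 1             = 1
jacobsthal (suc (suc n)) = jacobsthal (suc n) + 2 * jacobsthal n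

JacobsthalRecurrence : (ℕ → ℕ) → Set
JacobsthalRecurrence f = ∀ n → f (suc (suc n)) ≡ f (suc n) + 2 * f n

jacobsthal-unique : ∀ {f g} → JacobsthalRecurrence f → JacobsthalRecurrence g →
  f 0 ≡ g 0 → f 1 ≡ g 1 → ∀ n → f n ≡ g n
jacobsthal-unique {f} {g} rec-f rec-g eq₀ eq₁ n = proj₁ (agree n)
  where
  agree : ∀ n → f n ≡ g n × f (suc n) ≡ g (suc n)
  agree zero    = eq₀ , eq₁
  agree (suc n) with agree n
  ... | eqₙ , eqₙ₊₁ = eqₙ₊₁ , trans (rec-f n) (trans (cong₂ (λ a b → a + 2 * b) eqₙ₊₁ eqₙ) (sym (rec-g n)))

jacobsthal-mono : ∀ n → jacobsthal n ≤ jacobsthal (suc n)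
jacobsthal-mono zero    = z≤n
jacobsthal-mono (suc n) = m≤m+n (jacobsthal (suc n)) _

jacobsthal-pos : ∀ n → 0 < jacobsthal (suc n)
jacobsthal-pos zero    = s≤s z≤n
jacobsthal-pos (suc n) = ≤-trans (jacobsthal-pos n) (jacobsthal-mono (suc n))

jacobsthal-strict : ∀ n → n ≢ 1 → jacobsthal n < jacobsthal (suc n)
jacobsthal-strict zero          _   = s≤s z≤n
jacobsthal-strict (suc zero)    n≢1 = ⊥-elim (n≢1 refl)
jacobsthal-strict (suc (suc n)) _   =
  m<m+n (jacobsthal (suc (suc n))) (≤-trans (jacobsthal-pos n) (m≤m+n _ _))

jacobsthal-product-mono : ∀ s t → jacobsthal s * jacobsthal t ≤ jacobsthal (suc s) * jacobsthal (suc t)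
jacobsthal-product-mono s t = *-mono-≤ (jacobsthal-mono s) (jacobsthal-mono t)

-- J 1 = J 2 is the only place where J fails to grow.
jacobsthal-product-strict : ∀ s t → ¬ (s ≡ 1 × t ≡ 1) →
  jacobsthal s * jacobsthal t < jacobsthal (suc s) * jacobsthal (suc t)
jacobsthal-product-strict s t ¬st with s ℕ.≟ 1 | t ℕ.≟ 1
... | yes refl | yes refl = ⊥-elim (¬st (refl , refl))
... | yes refl | no t≢1   = *-monoʳ-< 1 (jacobsthal-strict t t≢1)
... | no s≢1   | _        = ≤-<-trans (*-monoʳ-≤ (jacobsthal s) (jacobsthal-mono t))
  (*-monoˡ-< (jacobsthal (suc t)) {{ℕ.>-nonZero (jacobsthal-pos t)}} (jacobsthal-strict s s≢1))

endCount : (Bool → Bool) → Bool → Bool → ℕ → ℕ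
endCount g p q n = count (λ d → g (overflow (zeros n) d p q)) (subsets n)

endCount-suc : ∀ g p q n → endCount g p q (suc n) ≡ endCount g q p n + endCount g q (q xor p) n
endCount-suc g p q n = count-subsets n (λ d → g (overflow (zeros (suc n)) d p q))

endCount-true : ∀ g p n → endCount g p true n ≡ endCount g false true n
endCount-true g p     zero    with g true
... | true  = refl
... | false = refl
endCount-true g false (suc n) = refl
endCount-true g true  (suc n) =
  trans (endCount-suc g true true n)
        (trans (+-comm (endCount g true true n) (endCount g true false n)) (sym (endCount-suc g false true n)))

endCount-jacobsthal : ∀ g → JacobsthalRecurrence (endCount g false true)
endCount-jacobsthal g n = begin
  endCount g false true (suc (suc n))
    ≡⟨ endCount-suc g false true (suc n) ⟩
  endCount g true false (suc n) + endCount g true true (suc n)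
    ≡⟨ cong₂ _+_ (endCount-suc g true false n) (endCount-true g true (suc n)) ⟩
  (endCount g false true n + endCount g false true n) + endCount g false true (suc n)
    ≡⟨ rearrange (endCount g false true n) (endCount g false true (suc n)) ⟩
  endCount g false true (suc n) + 2 * endCount g false true n ∎
  where
  open ≡-Reasoning
  rearrange : ∀ a b → (a + a) + b ≡ b + 2 * a
  rearrange = solve-∀

singularCount : ∀ n → endCount not false true n ≡ jacobsthal n
singularCount = jacobsthal-unique (endCount-jacobsthal not) (λ _ → refl) refl refl

nonsingularCount : ∀ n → endCount id false true n ≡ jacobsthal (suc n)
nonsingularCount = jacobsthal-unique (endCount-jacobsthal id) (λ _ → refl) refl refl

splitCount : (Bool → Bool) → ℕ → Bool → Bool → ℕ → ℕ
splitCount g s p q n =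
  count (λ d → not (overflow (zeros n) d p q) ∧ g (entry (solution (zeros n) d p q) s)) (subsets n)

splitCount-suc : ∀ g s p q n →
  splitCount g (suc s) p q (suc n) ≡ splitCount g s q p n + splitCount g s q (q xor p) n
splitCount-suc g s p q n = count-subsets n
  (λ d → not (overflow (zeros (suc n)) d p q) ∧ g (entry (solution (zeros (suc n)) d p q) (suc s)))

-- Entry s of a solution is the second component of its state after s steps, and the rest of the
-- count depends only on that state; when the entry is 1 the state is (0, 1) or (1, 1), which give
-- the same count.
splitCount-id : ∀ s p q r →
  splitCount id s p q (s + suc r) ≡ endCount id p q s * endCount not false true (suc r)
splitCount-id zero p true r = begin
  splitCount id 0 p true (suc r)      ≡⟨ count-cong (λ { (_ ∷ _) → ∧-identityʳ _ }) (subsets (suc r)) ⟩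
  endCount not p true (suc r)         ≡⟨ endCount-true not p (suc r) ⟩
  endCount not false true (suc r)     ≡⟨ sym (+-identityʳ _) ⟩
  1 * endCount not false true (suc r) ∎
  where open ≡-Reasoning
splitCount-id zero p false r =
  trans (count-cong (λ { (_ ∷ _) → ∧-zeroʳ _ }) (subsets (suc r))) (count-false (subsets (suc r)))
splitCount-id (suc s) p q r = begin
  splitCount id (suc s) p q (suc s + suc r)
    ≡⟨ splitCount-suc id s p q (s + suc r) ⟩
  splitCount id s q p (s + suc r) + splitCount id s q (q xor p) (s + suc r)
    ≡⟨ cong₂ _+_ (splitCount-id s q p r) (splitCount-id s q (q xor p) r) ⟩
  endCount id q p s * K + endCount id q (q xor p) s * K
    ≡⟨ sym (*-distribʳ-+ K (endCount id q p s) _) ⟩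
  (endCount id q p s + endCount id q (q xor p) s) * K
    ≡⟨ cong (_* K) (sym (endCount-suc id p q s)) ⟩
  endCount id p q (suc s) * K ∎
  where
  open ≡-Reasoning
  K = endCount not false true (suc r)

splitCount-not : ∀ s p q r → p ∨ q ≡ true →
  splitCount not s p q (s + suc r) ≡ endCount not p q s * endCount not true false (suc r)
splitCount-not zero p true r _ =
  trans (count-cong (λ { (_ ∷ _) → ∧-zeroʳ _ }) (subsets (suc r))) (count-false (subsets (suc r)))
splitCount-not zero true false r _ =
  trans (count-cong (λ { (_ ∷ _) → ∧-identityʳ _ }) (subsets (suc r))) (sym (+-identityʳ _))
splitCount-not (suc s) p q r nz = begin
  splitCount not (suc s) p q (suc s + suc r)
    ≡⟨ splitCount-suc not s p q (s + suc r) ⟩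
  splitCount not s q p (s + suc r) + splitCount not s q (q xor p) (s + suc r)
    ≡⟨ cong₂ _+_ (splitCount-not s q p r (nonzero-next false p q nz))
                 (splitCount-not s q (q xor p) r (nonzero-next true p q nz)) ⟩
  endCount not q p s * K + endCount not q (q xor p) s * K
    ≡⟨ sym (*-distribʳ-+ K (endCount not q p s) _) ⟩
  (endCount not q p s + endCount not q (q xor p) s) * K
    ≡⟨ cong (_* K) (sym (endCount-suc not p q s)) ⟩
  endCount not p q (suc s) * K ∎
  where
  open ≡-Reasoning
  K = endCount not true false (suc r)

-- The graph Γ(s, t)

-- Restated for every size n ≥ 1: the size pathLen (s ∷ t ∷ []) is not syntactically a successor.
A-condition′ : ∀ {n} → 1 ≤ n → ∀ c (e d : Vec Bool n) →
  does (rank (tridiagonal d) ℕ.≟ (suc n ∸ 2)) ∧ does (rank (bordered c e d) ℕ.≟ suc n)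
    ≡ not (overflow (zeros n) d false true) ∧ (solution (zeros n) d false true · e)
A-condition′ {suc m} _ = BorderedPath.A-condition

B-condition′ : ∀ {n} → 1 ≤ n → ∀ c (e d : Vec Bool n) →
  does (rank (tridiagonal d) ℕ.≟ (suc n ∸ 2)) ∧ does (rank (bordered c e d) ℕ.≟ (suc n ∸ 1))
    ≡ (not (overflow (zeros n) d false true) ∧ not (solution (zeros n) d false true · e))
        ∧ (c xor (solution e d false false · e))
B-condition′ {suc m} _ = BorderedPath.B-condition

repMat≗bordered : ∀ s t c (d : Vec Bool (pathLen (s ∷ t ∷ []))) i j →
  repMat (s ∷ t ∷ []) (c ∷ d) i j ≡ bordered c (unit s _) d i j
repMat≗bordered s t c d zero    zero    = refl
repMat≗bordered s t c d zero    (suc j) = trans (∨-identityʳ _) (sym (lookup-unit s j))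
repMat≗bordered s t c d (suc i) zero    = trans (∨-identityʳ _) (sym (lookup-unit s i))
repMat≗bordered s t c d (suc i) (suc j) = refl

module _ (s t : ℕ) where

  private
    n : ℕ
    n = pathLen (s ∷ t ∷ [])

    n≥1 : 1 ≤ n
    n≥1 = m≤n+m 1 (s + (t + 0))

    n≡s+1+t : n ≡ s + suc t
    n≡s+1+t = lemma s t
      where
      lemma : ∀ s t → s + (t + 0) + 1 ≡ s + suc t
      lemma = solve-∀

    v : Vec Bool n → Vec Bool n
    v d = solution (zeros n) d false true

    δ : Vec Bool n → Bool
    δ d = overflow (zeros n) d false true

    repMat-ranks : ∀ c d (k l : ℕ) →
      does (rank (lowerRight (repMat (s ∷ t ∷ []) (c ∷ d))) ℕ.≟ k)
        ∧ does (rank (repMat (s ∷ t ∷ []) (c ∷ d)) ℕ.≟ l)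
        ≡ does (rank (tridiagonal d) ℕ.≟ k) ∧ does (rank (bordered c (unit s n) d) ℕ.≟ l)
    repMat-ranks c d k l = cong₂ (λ a b → does (a ℕ.≟ k) ∧ does (b ℕ.≟ l))
      (rank-cong (λ i j → repMat≗bordered s t c d (suc i) (suc j)))
      (rank-cong (repMat≗bordered s t c d))

  countA-Γ : countA (s ∷ t ∷ []) ≡ 2 * (jacobsthal (suc s) * jacobsthal (suc t))
  countA-Γ = begin
    countA (s ∷ t ∷ [])
      ≡⟨ count-filterᵇ _ _ (subsets (suc n)) ⟩
    count _ (subsets (suc n))
      ≡⟨ count-subsets n _ ⟩
    count _ (subsets n) + count _ (subsets n)
      ≡⟨ cong₂ _+_ (count-cong (condition false) (subsets n)) (count-cong (condition true) (subsets n)) ⟩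
    splitCount id s false true n + splitCount id s false true n
      ≡⟨ cong (λ k → splitCount id s false true k + splitCount id s false true k) n≡s+1+t ⟩
    S + S
      ≡⟨ cong (λ k → k + k)
           (trans (splitCount-id s false true t) (cong₂ _*_ (nonsingularCount s) (singularCount (suc t)))) ⟩
    a + a
      ≡⟨ cong (λ x → a + x) (sym (+-identityʳ a)) ⟩
    2 * a ∎
    where
    open ≡-Reasoning
    S = splitCount id s false true (s + suc t)
    a = jacobsthal (suc s) * jacobsthal (suc t)
    condition : ∀ c d → _ ≡ not (δ d) ∧ entry (v d) s
    condition c d = trans (repMat-ranks c d _ _)
      (trans (A-condition′ n≥1 c (unit s n) d) (cong (not (δ d) ∧_) (·-unit s (v d))))

  countB-Γ : countB (s ∷ t ∷ []) ≡ 2 * (jacobsthal s * jacobsthal t)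
  countB-Γ = begin
    countB (s ∷ t ∷ [])
      ≡⟨ count-filterᵇ _ _ (subsets (suc n)) ⟩
    count _ (subsets (suc n))
      ≡⟨ count-subsets n _ ⟩
    count _ (subsets n) + count _ (subsets n)
      ≡⟨ cong₂ _+_ (count-cong (condition false) (subsets n)) (count-cong (condition true) (subsets n)) ⟩
    count (λ d → q d ∧ w d) (subsets n) + count (λ d → q d ∧ not (w d)) (subsets n)
      ≡⟨ count-∧-not q w (subsets n) ⟩
    splitCount not s false true n
      ≡⟨ cong (splitCount not s false true) n≡s+1+t ⟩
    splitCount not s false true (s + suc t)
      ≡⟨ trans (splitCount-not s false true t refl)
               (cong (endCount not false true s *_) (endCount-suc not true false t)) ⟩
    endCount not false true s * (endCount not false true t + endCount not false true t)
      ≡⟨ cong₂ (λ a b → a * (b + b)) (singularCount s) (singularCount t) ⟩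
    jacobsthal s * (jacobsthal t + jacobsthal t)
      ≡⟨ rearrange (jacobsthal s) (jacobsthal t) ⟩
    2 * (jacobsthal s * jacobsthal t) ∎
    where
    open ≡-Reasoning
    q : Vec Bool n → Bool
    q d = not (δ d) ∧ not (entry (v d) s)
    w : Vec Bool n → Bool
    w d = solution (unit s n) d false false · unit s n
    condition : ∀ c d → _ ≡ q d ∧ (c xor w d)
    condition c d = trans (repMat-ranks c d _ _)
      (trans (B-condition′ n≥1 c (unit s n) d)
             (cong (λ x → (not (δ d) ∧ not x) ∧ (c xor w d)) (·-unit s (v d))))
    rearrange : ∀ a b → a * (b + b) ≡ 2 * (a * b)
    rearrange = solve-∀

  α-Γ : α (s ∷ t ∷ []) ≡
        + (2 * (jacobsthal (suc s) * jacobsthal (suc t)) ∸ 2 * (jacobsthal s * jacobsthal t))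
  α-Γ rewrite countA-Γ | countB-Γ =
    trans (m-n≡m⊖n (2 * (jacobsthal (suc s) * jacobsthal (suc t))) (2 * (jacobsthal s * jacobsthal t)))
          (⊖-≥ (*-mono-≤ (≤-refl {2}) (jacobsthal-product-mono s t)))

mainTheorem10 : (s t : ℕ) →
    (+ 0 ℤ.≤ α (s ∷ t ∷ [])) × ((α (s ∷ t ∷ []) ≡ + 0) ⇔ (s ≡ 1 × t ≡ 1))
mainTheorem10 s t rewrite α-Γ s t = +≤+ z≤n , mk⇔ vanishing⇒s≡t≡1 (λ { (refl , refl) → refl })
  where
  vanishing⇒s≡t≡1 :
    + (2 * (jacobsthal (suc s) * jacobsthal (suc t)) ∸ 2 * (jacobsthal s * jacobsthal t)) ≡ + 0 → s ≡ 1 × t ≡ 1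
  vanishing⇒s≡t≡1 α≡0 = decidable-stable ((s ℕ.≟ 1) ×-dec (t ℕ.≟ 1)) λ ¬s≡t≡1 →
    <⇒≱ (*-monoʳ-< 2 (jacobsthal-product-strict s t ¬s≡t≡1)) (m∸n≡0⇒m≤n (+-injective α≡0))
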